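{- In the branch structure $\mathcal{M}_{\mathcal{B}}=\langle U,D,\tilde\neg,\tilde\to,\tilde\equiv\rangle$ defined in the context, $\tilde\equiv$ is a function on $U$ (each pair $(w,v)\in U\times U$ is assigned exactly one value) and for all $w,v\in U$: $w\tilde\equiv v\in D$ iff $w=v$.
   Context: SCI-formulas: over a countably infinite set $\mathsf{AF}$ of atoms, $\varphi ::= p \mid \neg\varphi \mid \varphi\to\varphi \mid \varphi\equiv\varphi$; $\mathsf{FOR}$ is the set of formulas. Tableau system $\mathsf{TC}_{\mathsf{SCI}}$. Let $\mathsf{L}^+,\mathsf{L}^-$ be disjoint countably infinite sets of labels, $\mathsf{L}=\mathsf{L}^+\cup\mathsf{L}^-$; a label written $w^+$ lies in $\mathsf{L}^+$, $w^-$ in $\mathsf{L}^-$, unsuperscripted labels are arbitrary. A labelled formula is $w:\varphi$; equality statements $w=v$ and inequality statements $w\neq v$ may also occur. A tableau is a tree whose nodes carry these items or $\bot$; a branch is a root-to-leaf path identified with its set of items. Rules (premises / alternative conclusion sets separated by $\mid$): decomposition rules (conclusion labels fresh on the branch): $(\neg^+)$ $w^+:\neg\varphi$ / $v^-:\varphi$; $(\neg^-)$ $w^-:\neg\varphi$ / $v^+:\varphi$; $(\to^+)$ $w^+:\varphi\to\psi$ / $\{v^-:\varphi,u^-:\psi\}\mid\{v^-:\varphi,u^+:\psi\}\mid\{v^+:\varphi,u^+:\psi\}$; $(\to^-)$ $w^-:\varphi\to\psi$ / $\{v^+:\varphi,u^-:\psi\}$; $(\equiv^+)$ $w^+:\varphi\equiv\psi$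 / $\{v^+:\varphi,u^+:\psi,v^+=u^+\}\mid\{v^-:\varphi,u^-:\psi,v^-=u^-\}$; $(\equiv^-)$ $w^-:\varphi\equiv\psi$ / $\{v^+:\varphi,u^+:\psi,v^+\neq u^+\}\mid\{v^+:\varphi,u^-:\psi\}\mid\{v^-:\varphi,u^+:\psi\}\mid\{v^-:\varphi,u^-:\psi,v^-\neq u^-\}$. Equality rules, with $\varphi\approx\psi$ abbreviating premises $w:\varphi$, $v:\psi$, $w=v$: $(\equiv^\neg)$ $\varphi\approx\psi$, $u:\neg\varphi$, $y:\neg\psi$ / $u=y$; $(\equiv^\to)$ $\varphi\approx\psi$, $\chi\approx\theta$, $x:\varphi\to\chi$, $z:\psi\to\theta$ / $x=z$; $(\equiv^\equiv)$ $\varphi\approx\psi$, $\chi\approx\theta$, $x:\varphi\equiv\chi$, $z:\psi\equiv\theta$ / $x=z$; $(\mathsf F)$ $w:\varphi$, $v:\varphi$ / $w=v$; $(\mathsf{sym})$ $w=v$ / $v=w$; $(\mathsf{tran})$ $w=v$, $v=u$ / $w=u$. Closure rules: $(\bot_1)$ $w=v$, $w\neq v$ / $\bot$; $(\bot_2)$ $w^+=v^-$ / $\bot$. A decomposition rule may be applied to $w:\varphi$ on a branch only once; an equality rule only if its conclusion is not yet on the branch; closure rules are applied eagerly. A branch is closed if a closure rule was applied on it, open otherwise; fully expanded if closed or no rule is applicable. Branch structure. Let $\varphi\in\mathsf{FOR}$, $\mathbf{w}^-\in\mathsf{L}^-$, and $\mathcal{B}$ an open fully expanded branch of a tableau with root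 $\mathbf{w}^-:\varphi$. $\mathsf{L}_{\mathcal{B}}$ is the set of labels $w$ with $w:\psi$ on $\mathcal{B}$ for some $\psi$; $\mathsf{L}_{\mathcal{B}}^\pm=\mathsf{L}_{\mathcal{B}}\cap\mathsf{L}^\pm$; $w\sim v$ iff $w=v$ occurs on $\mathcal{B}$ (an equivalence relation on $\mathsf{L}_{\mathcal{B}}$ never relating a label in $\mathsf{L}^+$ to one in $\mathsf{L}^-$). $\mathsf{ML}_{\mathcal{B}}^+$ contains exactly one label from each $\sim$-class of $\mathsf{L}_{\mathcal{B}}^+$; $\mathsf{ML}_{\mathcal{B}}^-$ exactly one label from each $\sim$-class of $\mathsf{L}_{\mathcal{B}}^-$, chosen with $\mathbf{w}^-\in\mathsf{ML}_{\mathcal{B}}^-$; $\mathsf{ML}_{\mathcal{B}}=\mathsf{ML}_{\mathcal{B}}^+\cup\mathsf{ML}_{\mathcal{B}}^-$. Let $\mathbf{w}^+$ be an object not in $\mathsf{L}_{\mathcal{B}}$; for $w\in U$ and a label $t$, "$w\sim t$" is false if $w=\mathbf{w}^+$. $w\in\mathsf{ML}_{\mathcal{B}}$ is $(\neg)$-closed if there are $\psi\in\mathsf{FOR}$, $u\in\mathsf{ML}_{\mathcal{B}}$, $v,t\in\mathsf{L}_{\mathcal{B}}$ with $w\sim v$, $u\sim t$, and $v:\psi$, $t:\neg\psi$ on $\mathcal{B}$. For $\#\in\{\to,\equiv\}$, a pair $(w,v)\in\mathsf{ML}_{\mathcal{B}}^2$ is $(\#)$-closed if there are $\psi,\theta\in\mathsf{FOR}$,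 $u\in\mathsf{ML}_{\mathcal{B}}$, $t,x,y\in\mathsf{L}_{\mathcal{B}}$ with $w\sim t$, $v\sim x$, $u\sim y$ and $t:\psi$, $x:\theta$, $y:(\psi\#\theta)$ on $\mathcal{B}$ ($\mathbf{w}^+$ is never $(\neg)$-closed, and pairs involving it are never closed). Set $D=\mathsf{ML}_{\mathcal{B}}^+\cup\{\mathbf{w}^+\}$, $U=D\cup\mathsf{ML}_{\mathcal{B}}^-$. For $w,v\in U$: $\tilde\neg w=u\in\mathsf{ML}_{\mathcal{B}}$ if there are $\psi$ and $v',t\in\mathsf{L}_{\mathcal{B}}$ with $w\sim v'$, $u\sim t$, $v':\psi$ and $t:\neg\psi$ on $\mathcal{B}$; $\tilde\neg w=\mathbf{w}^+$ if $w$ is not $(\neg)$-closed and $w\notin D$; $\tilde\neg w=\mathbf{w}^-$ otherwise. $w\tilde\to v=u\in\mathsf{ML}_{\mathcal{B}}$ if there are $\psi,\theta$ and $t,x,y\in\mathsf{L}_{\mathcal{B}}$ with $w\sim t$, $v\sim x$, $u\sim y$, $t:\psi$, $x:\theta$, $y:(\psi\to\theta)$ on $\mathcal{B}$; $w\tilde\to v=\mathbf{w}^+$ if $v=\mathbf{w}^+$, or ($w=\mathbf{w}^+$ and $v\in D$), or ($(w,v)$ is not $(\to)$-closed and ($w\notin D$ or $v\in D$)); $w\tilde\to v=\mathbf{w}^-$ otherwise. $w\tilde\equiv v=u\in\mathsf{ML}_{\mathcal{B}}$ if there are $\psi,\theta$ and $t,x,y\in\mathsf{L}_{\mathcal{B}}$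 with $w\sim t$, $v\sim x$, $u\sim y$, $t:\psi$, $x:\theta$, $y:(\psi\equiv\theta)$ on $\mathcal{B}$; $w\tilde\equiv v=\mathbf{w}^+$ if $w=v$ and ($w=\mathbf{w}^+$ or $(w,v)$ is not $(\equiv)$-closed); $w\tilde\equiv v=\mathbf{w}^-$ otherwise. $\mathcal{M}_{\mathcal{B}}=\langle U,D,\tilde\neg,\tilde\to,\tilde\equiv\rangle$. -}

module Defs where

open import Data.Nat using (ℕ)
open import Data.Product using (Σ; ∃; ∃-syntax; _×_; _,_)
open import Data.Sum using (_⊎_)
open import Data.Empty using (⊥)
open import Data.Unit using (⊤)
open import Data.List using (List; []; _∷_; _++_)
open import Data.List.Membership.Propositional using (_∈_; _∉_)
open import Data.List.Relation.Unary.Any using (Any)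
open import Data.List.Relation.Unary.All using (All)
open import Data.List.Relation.Unary.Unique.Propositional using (Unique)
open import Relation.Nullary using (¬_)
open import Relation.Binary.PropositionalEquality using (_≡_)

-- SCI formulas over the countably infinite set of atoms AF = ℕ

data Form : Set where
  atom : ℕ → Form
  ¬'_  : Form → Form
  _⇒_  : Form → Form → Form
  _≣_  : Form → Form → Form

-- Labels: L = L⁺ ∪ L⁻, realised as Sign × ℕ (disjoint, countably infinite)

data Sign : Set where
  pos neg : Sign

Label : Set
Label = Sign × ℕ

data Item : Set where
  _∶_   : Label → Form → Item
  _≐_   : Label → Label → Item
  _≠'_  : Label → Label → Item
  ⊥i    : Item

Branch : Set
Branch = List Item

Mentions : Label → Item → Set
Mentions l (w ∶ φ)  = l ≡ w
Mentions l (w ≐ v)  = l ≡ w ⊎ l ≡ v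
Mentions l (w ≠' v) = l ≡ w ⊎ l ≡ v
Mentions l ⊥i       = ⊥

Fresh : Label → Branch → Set
Fresh l B = ¬ Any (Mentions l) B

-- Decomposition rules:  Dec premise freshLabels conclusionSet
-- (one constructor per alternative conclusion set; v, u are the new labels)

data Dec : Item → List Label → List Item → Set where
  ¬⁺  : ∀ {w v φ} → Dec ((pos , w) ∶ (¬' φ)) ((neg , v) ∷ [])
                        (((neg , v) ∶ φ) ∷ [])
  ¬⁻  : ∀ {w v φ} → Dec ((neg , w) ∶ (¬' φ)) ((pos , v) ∷ [])
                        (((pos , v) ∶ φ) ∷ [])
  ⇒⁺₁ : ∀ {w v u φ ψ} → Dec ((pos , w) ∶ (φ ⇒ ψ)) ((neg , v) ∷ (neg , u) ∷ [])
                        (((neg , v) ∶ φ) ∷ ((neg , u) ∶ ψ) ∷ [])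
  ⇒⁺₂ : ∀ {w v u φ ψ} → Dec ((pos , w) ∶ (φ ⇒ ψ)) ((neg , v) ∷ (pos , u) ∷ [])
                        (((neg , v) ∶ φ) ∷ ((pos , u) ∶ ψ) ∷ [])
  ⇒⁺₃ : ∀ {w v u φ ψ} → Dec ((pos , w) ∶ (φ ⇒ ψ)) ((pos , v) ∷ (pos , u) ∷ [])
                        (((pos , v) ∶ φ) ∷ ((pos , u) ∶ ψ) ∷ [])
  ⇒⁻  : ∀ {w v u φ ψ} → Dec ((neg , w) ∶ (φ ⇒ ψ)) ((pos , v) ∷ (neg , u) ∷ [])
                        (((pos , v) ∶ φ) ∷ ((neg , u) ∶ ψ) ∷ [])
  ≣⁺₁ : ∀ {w v u φ ψ} → Dec ((pos , w) ∶ (φ ≣ ψ)) ((pos , v) ∷ (pos , u) ∷ [])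
                        (((pos , v) ∶ φ) ∷ ((pos , u) ∶ ψ) ∷ ((pos , v) ≐ (pos , u)) ∷ [])
  ≣⁺₂ : ∀ {w v u φ ψ} → Dec ((pos , w) ∶ (φ ≣ ψ)) ((neg , v) ∷ (neg , u) ∷ [])
                        (((neg , v) ∶ φ) ∷ ((neg , u) ∶ ψ) ∷ ((neg , v) ≐ (neg , u)) ∷ [])
  ≣⁻₁ : ∀ {w v u φ ψ} → Dec ((neg , w) ∶ (φ ≣ ψ)) ((pos , v) ∷ (pos , u) ∷ [])
                        (((pos , v) ∶ φ) ∷ ((pos , u) ∶ ψ) ∷ ((pos , v) ≠' (pos , u)) ∷ [])
  ≣⁻₂ : ∀ {w v u φ ψ} → Dec ((neg , w) ∶ (φ ≣ ψ)) ((pos , v) ∷ (neg , u) ∷ [])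
                        (((pos , v) ∶ φ) ∷ ((neg , u) ∶ ψ) ∷ [])
  ≣⁻₃ : ∀ {w v u φ ψ} → Dec ((neg , w) ∶ (φ ≣ ψ)) ((neg , v) ∷ (pos , u) ∷ [])
                        (((neg , v) ∶ φ) ∷ ((pos , u) ∶ ψ) ∷ [])
  ≣⁻₄ : ∀ {w v u φ ψ} → Dec ((neg , w) ∶ (φ ≣ ψ)) ((neg , v) ∷ (neg , u) ∷ [])
                        (((neg , v) ∶ φ) ∷ ((neg , u) ∶ ψ) ∷ ((neg , v) ≠' (neg , u)) ∷ [])

data EqR (B : Branch) : Item → Set where
  r≡¬ : ∀ {w v u y φ ψ} →
        (w ∶ φ) ∈ B → (v ∶ ψ) ∈ B → (w ≐ v) ∈ B →
        (u ∶ (¬' φ)) ∈ B → (y ∶ (¬' ψ)) ∈ B → EqR B (u ≐ y)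
  r≡⇒ : ∀ {w v w' v' x z φ ψ χ θ} →
        (w ∶ φ) ∈ B → (v ∶ ψ) ∈ B → (w ≐ v) ∈ B →
        (w' ∶ χ) ∈ B → (v' ∶ θ) ∈ B → (w' ≐ v') ∈ B →
        (x ∶ (φ ⇒ χ)) ∈ B → (z ∶ (ψ ⇒ θ)) ∈ B → EqR B (x ≐ z)
  r≡≣ : ∀ {w v w' v' x z φ ψ χ θ} →
        (w ∶ φ) ∈ B → (v ∶ ψ) ∈ B → (w ≐ v) ∈ B →
        (w' ∶ χ) ∈ B → (v' ∶ θ) ∈ B → (w' ≐ v') ∈ B →
        (x ∶ (φ ≣ χ)) ∈ B → (z ∶ (ψ ≣ θ)) ∈ B → EqR B (x ≐ z)
  rF   : ∀ {w v φ} → (w ∶ φ) ∈ B → (v ∶ φ) ∈ B → EqR B (w ≐ v)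
  rsym : ∀ {w v} → (w ≐ v) ∈ B → EqR B (v ≐ w)
  rtran : ∀ {w v u} → (w ≐ v) ∈ B → (v ≐ u) ∈ B → EqR B (w ≐ u)

data Clo (B : Branch) : Set where
  cl₁ : ∀ {w v} → (w ≐ v) ∈ B → (w ≠' v) ∈ B → Clo B
  cl₂ : ∀ {w v} → ((pos , w) ≐ (neg , v)) ∈ B → Clo B

-- Branch states: the items on the branch together with the list of
-- labelled formulas to which a decomposition rule has already been applied.

State : Set
State = Branch × List Item

data Step : State → State → Set where
  sDec : ∀ {B used p ls C} → Dec p ls C → p ∈ B → p ∉ used →
         All (λ l → Fresh l B) ls → Unique ls →
         Step (B , used) (B ++ C , p ∷ used)
  sEq  : ∀ {B used c} → EqR B c → c ∉ B →
         Step (B , used) (B ++ (c ∷ []) , used)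
  sClo : ∀ {B used} → Clo B → ⊥i ∉ B →
         Step (B , used) (B ++ (⊥i ∷ []) , used)

-- branches of tableaux with root  (neg , w) : φ
data Reach (φ : Form) (w : ℕ) : State → Set where
  root : Reach φ w ((((neg , w) ∶ φ) ∷ []) , [])
  step : ∀ {s s'} → Reach φ w s → Step s s' → Reach φ w s'

Closed : State → Set
Closed (B , _) = ⊥i ∈ B

Open : State → Set
Open s = ¬ Closed s

FullyExpanded : State → Set
FullyExpanded s = Closed s ⊎ (∀ s' → ¬ Step s s')

InL : Branch → Label → Set
InL B l = ∃[ φ ] (l ∶ φ) ∈ B

_⊢_∼_ : Branch → Label → Label → Set
B ⊢ w ∼ v = (w ≐ v) ∈ B

record Representatives (B : Branch) (w : ℕ) (ML : List Label) : Set where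
  field
    sub   : ∀ {m} → m ∈ ML → InL B m
    cover : ∀ {l} → InL B l → ∃[ m ] (m ∈ ML × B ⊢ l ∼ m)
    uniq  : ∀ {m m'} → m ∈ ML → m' ∈ ML → B ⊢ m ∼ m' → m ≡ m'
    root∈ : (neg , w) ∈ ML

-- elements of U:  top is the new object w⁺, lab l a label of ML
data UE : Set where
  top : UE
  lab : Label → UE

InU : List Label → UE → Set
InU ML top     = ⊤
InU ML (lab l) = l ∈ ML

InD : List Label → UE → Set
InD ML top             = ⊤
InD ML (lab (s , n))   = (s , n) ∈ ML × s ≡ pos

SimU : Branch → UE → Label → Set
SimU B top     t = ⊥
SimU B (lab l) t = B ⊢ l ∼ t

EqvCond : Branch → UE → UE → Label → Set
EqvCond B w v u = ∃[ ψ ] ∃[ θ ] ∃[ t ] ∃[ x ] ∃[ y ]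
  (SimU B w t × SimU B v x × B ⊢ u ∼ y ×
   (t ∶ ψ) ∈ B × (x ∶ θ) ∈ B × (y ∶ (ψ ≣ θ)) ∈ B)

EqvClosed : Branch → List Label → UE → UE → Set
EqvClosed B ML w v = ∃[ u ] (u ∈ ML × EqvCond B w v u)

EqvTopCond : Branch → List Label → UE → UE → Set
EqvTopCond B ML w v = w ≡ v × (w ≡ top ⊎ ¬ EqvClosed B ML w v)

-- EqvVal B ML w₀ w v z :  z is a value assigned to w ≡̃ v by the definition
-- (w₀ is the index of the root label (neg , w₀) = 𝐰⁻)
data EqvVal (B : Branch) (ML : List Label) (w₀ : ℕ) (w v : UE) : UE → Set where
  c₁ : ∀ {u} → u ∈ ML → EqvCond B w v u → EqvVal B ML w₀ w v (lab u)
  c₂ : EqvTopCond B ML w v → EqvVal B ML w₀ w v top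
  c₃ : ¬ EqvClosed B ML w v → ¬ EqvTopCond B ML w v →
       EqvVal B ML w₀ w v (lab (neg , w₀))

-- On an open fully expanded branch every equality rule has already been applied
-- and every formula ψ ≡ θ has been decomposed, since fresh labels are always
-- available.  Hence a label y : ψ ≡ θ in L⁺ forces the labels of ψ and θ into one
-- class (both alternatives of (≡⁺) assert v = u), while one in L⁻ forces them
-- into different classes (each alternative of (≡⁻) closes the branch otherwise).
-- So the first clause of ≡̃ yields a designated value exactly on the diagonal;
-- it yields at most one value because (≡≡) merges the classes of all labels
-- carrying ψ ≡ θ with components in the same classes, and ML has one label per
-- class.  The other two clauses are mutually exclusive and exhaustive once
-- (≡)-closedness is decided, which is a finite search on the branch.
module Submission where

open import Defs
open import Data.Nat using (ℕ)
open import Data.Product using (∃-syntax; _×_; _,_)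
open import Data.List using (List)
open import Relation.Binary.PropositionalEquality using (_≡_)
open import Function.Bundles using (_⇔_)

open import Data.Nat as ℕ using (suc; _⊔_; _≤_; _<_)
open import Data.Nat.Properties using (1+n≢n; ≤-refl; ≤-trans; m≤m⊔n; m≤n⊔m; <⇒≱; n<1+n; m<n⇒m<1+n)
open import Data.Product using (∃₂; proj₁; proj₂)
open import Data.Product.Properties using (≡-dec)
open import Data.Sum using (inj₁; inj₂; [_,_])
open import Data.Empty using (⊥; ⊥-elim)
open import Data.Unit using (tt)
open import Data.List using ([]; _∷_; _++_)
open import Data.List.Relation.Unary.Any using (Any; here; there; any?)
open import Data.List.Relation.Unary.All using (All; []; _∷_)
open import Data.List.Relation.Unary.AllPairs using ([]; _∷_)
open import Data.List.Relation.Unary.Unique.Propositional using (Unique)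
open import Data.List.Membership.Propositional using (_∈_; _∉_; find; lose)
open import Data.List.Relation.Binary.Subset.Propositional using (_⊆_)
open import Data.List.Relation.Binary.Subset.Propositional.Properties
  using (⊆-trans; xs⊆xs++ys; xs⊆ys++xs)
open import Function.Base using (_∘_)
open import Function.Bundles using (mk⇔)
import Relation.Nullary as Nullary
open import Relation.Nullary using (¬_; yes; no)
open import Relation.Nullary.Decidable using (map; map′; _×-dec_)
open import Relation.Binary.Definitions using (DecidableEquality; Decidable)
open import Relation.Binary.PropositionalEquality using (refl; sym; cong)

_≟ˢ_ : DecidableEquality Sign
pos ≟ˢ pos = yes refl
pos ≟ˢ neg = no λ ()
neg ≟ˢ pos = no λ ()
neg ≟ˢ neg = yes refl

_≟ˡ_ : DecidableEquality Label
_≟ˡ_ = ≡-dec _≟ˢ_ ℕ._≟_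

_≟ᶠ_ : DecidableEquality Form
atom m  ≟ᶠ atom n    = map′ (cong atom) (λ { refl → refl }) (m ℕ.≟ n)
(¬' φ)  ≟ᶠ (¬' φ')   = map′ (cong ¬'_) (λ { refl → refl }) (φ ≟ᶠ φ')
(φ ⇒ ψ) ≟ᶠ (φ' ⇒ ψ') =
  map′ (λ { (refl , refl) → refl }) (λ { refl → refl , refl }) (φ ≟ᶠ φ' ×-dec ψ ≟ᶠ ψ')
(φ ≣ ψ) ≟ᶠ (φ' ≣ ψ') =
  map′ (λ { (refl , refl) → refl }) (λ { refl → refl , refl }) (φ ≟ᶠ φ' ×-dec ψ ≟ᶠ ψ')
atom _  ≟ᶠ (¬' _)  = no λ ()
atom _  ≟ᶠ (_ ⇒ _) = no λ ()
atom _  ≟ᶠ (_ ≣ _) = no λ ()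
(¬' _)  ≟ᶠ atom _  = no λ ()
(¬' _)  ≟ᶠ (_ ⇒ _) = no λ ()
(¬' _)  ≟ᶠ (_ ≣ _) = no λ ()
(_ ⇒ _) ≟ᶠ atom _  = no λ ()
(_ ⇒ _) ≟ᶠ (¬' _)  = no λ ()
(_ ⇒ _) ≟ᶠ (_ ≣ _) = no λ ()
(_ ≣ _) ≟ᶠ atom _  = no λ ()
(_ ≣ _) ≟ᶠ (¬' _)  = no λ ()
(_ ≣ _) ≟ᶠ (_ ⇒ _) = no λ ()

_≟ⁱ_ : DecidableEquality Item
(w ∶ φ)  ≟ⁱ (w' ∶ φ')  =
  map′ (λ { (refl , refl) → refl }) (λ { refl → refl , refl }) (w ≟ˡ w' ×-dec φ ≟ᶠ φ')
(w ≐ v)  ≟ⁱ (w' ≐ v')  =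
  map′ (λ { (refl , refl) → refl }) (λ { refl → refl , refl }) (w ≟ˡ w' ×-dec v ≟ˡ v')
(w ≠' v) ≟ⁱ (w' ≠' v') =
  map′ (λ { (refl , refl) → refl }) (λ { refl → refl , refl }) (w ≟ˡ w' ×-dec v ≟ˡ v')
⊥i ≟ⁱ ⊥i = yes refl
(_ ∶ _)  ≟ⁱ (_ ≐ _)  = no λ ()
(_ ∶ _)  ≟ⁱ (_ ≠' _) = no λ ()
(_ ∶ _)  ≟ⁱ ⊥i       = no λ ()
(_ ≐ _)  ≟ⁱ (_ ∶ _)  = no λ ()
(_ ≐ _)  ≟ⁱ (_ ≠' _) = no λ ()
(_ ≐ _)  ≟ⁱ ⊥i       = no λ ()
(_ ≠' _) ≟ⁱ (_ ∶ _)  = no λ ()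
(_ ≠' _) ≟ⁱ (_ ≐ _)  = no λ ()
(_ ≠' _) ≟ⁱ ⊥i       = no λ ()
⊥i       ≟ⁱ (_ ∶ _)  = no λ ()
⊥i       ≟ⁱ (_ ≐ _)  = no λ ()
⊥i       ≟ⁱ (_ ≠' _) = no λ ()

open import Data.List.Membership.DecPropositional _≟ⁱ_ using (_∈?_)

_≟ᵘ_ : DecidableEquality UE
top   ≟ᵘ top    = yes refl
top   ≟ᵘ lab _  = no λ ()
lab _ ≟ᵘ top    = no λ ()
lab l ≟ᵘ lab l' = map′ (cong lab) (λ { refl → refl }) (l ≟ˡ l')

Labelled : Branch → (Label → Form → Set) → Set
Labelled B P = ∃[ l ] ∃[ φ ] ((l ∶ φ) ∈ B × P l φ)

OnLabelled : (Label → Form → Set) → Item → Set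
OnLabelled P (l ∶ φ) = P l φ
OnLabelled P _       = ⊥

onLabelled? : ∀ {P} → Decidable P → ∀ i → Nullary.Dec (OnLabelled P i)
onLabelled? P? (l ∶ φ)  = P? l φ
onLabelled? P? (_ ≐ _)  = no λ ()
onLabelled? P? (_ ≠' _) = no λ ()
onLabelled? P? ⊥i       = no λ ()

any-onLabelled⇔labelled : ∀ {P B} → Any (OnLabelled P) B ⇔ Labelled B P
any-onLabelled⇔labelled {P} = mk⇔ (from-find ∘ find) (λ (_ , _ , l∶φ∈B , p) → lose l∶φ∈B p)
  where
  from-find : ∀ {B} → ∃[ i ] (i ∈ B × OnLabelled P i) → Labelled B P
  from-find ((l ∶ φ) , i∈B , p) = l , φ , i∈B , p
  from-find ((_ ≐ _) , _ , ())
  from-find ((_ ≠' _) , _ , ())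
  from-find (⊥i , _ , ())

labelled? : ∀ {P} → Decidable P → ∀ B → Nullary.Dec (Labelled B P)
labelled? P? B = map any-onLabelled⇔labelled (any? (onLabelled? P?) B)

indexBound : Item → ℕ
indexBound ((_ , m) ∶ _)        = m
indexBound ((_ , m) ≐ (_ , n))  = m ⊔ n
indexBound ((_ , m) ≠' (_ , n)) = m ⊔ n
indexBound ⊥i                   = 0

branchBound : Branch → ℕ
branchBound []      = 0
branchBound (i ∷ B) = indexBound i ⊔ branchBound B

mentioned≤indexBound : ∀ {s k} i → Mentions (s , k) i → k ≤ indexBound i
mentioned≤indexBound ((_ , m) ∶ _)        refl        = ≤-refl
mentioned≤indexBound ((_ , m) ≐ (_ , n))  (inj₁ refl) = m≤m⊔n m n
mentioned≤indexBound ((_ , m) ≐ (_ , n))  (inj₂ refl) = m≤n⊔m m n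
mentioned≤indexBound ((_ , m) ≠' (_ , n)) (inj₁ refl) = m≤m⊔n m n
mentioned≤indexBound ((_ , m) ≠' (_ , n)) (inj₂ refl) = m≤n⊔m m n

mentioned≤branchBound : ∀ {s k} B → Any (Mentions (s , k)) B → k ≤ branchBound B
mentioned≤branchBound (i ∷ B) (here m) = ≤-trans (mentioned≤indexBound i m) (m≤m⊔n _ _)
mentioned≤branchBound (i ∷ B) (there m) = ≤-trans (mentioned≤branchBound B m) (m≤n⊔m _ _)

fresh : ∀ {s k} B → branchBound B < k → Fresh (s , k) B
fresh B bound<k m = <⇒≱ bound<k (mentioned≤branchBound B m)

Decomposed : State → Set
Decomposed (B , used) = ∀ {p} → p ∈ used → ∃₂ λ ls C → Dec p ls C × C ⊆ B

decomposed-++ : ∀ {B used} D → Decomposed (B , used) → Decomposed (B ++ D , used)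
decomposed-++ {B} D dec p∈ with dec p∈
... | ls , C , d , C⊆B = ls , C , d , ⊆-trans C⊆B (xs⊆xs++ys B D)

reach⇒decomposed : ∀ {φ w s} → Reach φ w s → Decomposed s
reach⇒decomposed root ()
reach⇒decomposed (step {s = B , _} r (sDec d _ _ _ _)) (here refl) = _ , _ , d , xs⊆ys++xs _ B
reach⇒decomposed (step r (sDec {C = C} _ _ _ _ _)) (there p∈) =
  decomposed-++ C (reach⇒decomposed r) p∈
reach⇒decomposed (step r (sEq _ _))  = decomposed-++ _ (reach⇒decomposed r)
reach⇒decomposed (step r (sClo _ _)) = decomposed-++ _ (reach⇒decomposed r)

module Saturated (B : Branch) (used : List Item)
  (stuck : ∀ s → ¬ Step (B , used) s) (⊥∉B : ⊥i ∉ B) (decomposed : Decomposed (B , used)) where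

  equalityRule-closed : ∀ {c} → EqR B c → c ∈ B
  equalityRule-closed {c} r with c ∈? B
  ... | yes c∈B = c∈B
  ... | no  c∉B = ⊥-elim (stuck _ (sEq r c∉B))

  closureRule-inapplicable : ¬ Clo B
  closureRule-inapplicable c = stuck _ (sClo c ⊥∉B)

  ∼-sym : ∀ {w v} → B ⊢ w ∼ v → B ⊢ v ∼ w
  ∼-sym w∼v = equalityRule-closed (rsym w∼v)

  ∼-trans : ∀ {w v u} → B ⊢ w ∼ v → B ⊢ v ∼ u → B ⊢ w ∼ u
  ∼-trans w∼v v∼u = equalityRule-closed (rtran w∼v v∼u)

  same-formula⇒∼ : ∀ {w v φ} → (w ∶ φ) ∈ B → (v ∶ φ) ∈ B → B ⊢ w ∼ v
  same-formula⇒∼ w∶φ v∶φ = equalityRule-closed (rF w∶φ v∶φ)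

  ∼-sign : ∀ {s s' m n} → B ⊢ (s , m) ∼ (s' , n) → s ≡ s'
  ∼-sign {pos} {pos} _ = refl
  ∼-sign {neg} {neg} _ = refl
  ∼-sign {pos} {neg} e = ⊥-elim (closureRule-inapplicable (cl₂ e))
  ∼-sign {neg} {pos} e = ⊥-elim (closureRule-inapplicable (cl₂ (∼-sym e)))

  ∼-transport : ∀ {t x v u ψ θ} → (t ∶ ψ) ∈ B → (x ∶ θ) ∈ B →
                (v ∶ ψ) ∈ B → (u ∶ θ) ∈ B → B ⊢ v ∼ u → B ⊢ t ∼ x
  ∼-transport t∶ψ x∶θ v∶ψ u∶θ v∼u =
    ∼-trans (same-formula⇒∼ t∶ψ v∶ψ) (∼-trans v∼u (same-formula⇒∼ u∶θ x∶θ))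

  decomposition-applied : ∀ {p ls C} → Dec p ls C →
    All (λ l → Fresh l B) ls → Unique ls → p ∈ B → p ∈ used
  decomposition-applied {p} d fresh-ls unique-ls p∈B with p ∈? used
  ... | yes p∈used = p∈used
  ... | no  p∉used = ⊥-elim (stuck _ (sDec d p∈B p∉used fresh-ls unique-ls))

  freshPair : Sign → Sign → List Label
  freshPair s s' = (s , suc (branchBound B)) ∷ (s' , suc (suc (branchBound B))) ∷ []

  freshPair-fresh : ∀ s s' → All (λ l → Fresh l B) (freshPair s s')
  freshPair-fresh s s' = fresh B (n<1+n _) ∷ fresh B (m<n⇒m<1+n (n<1+n _)) ∷ []

  freshPair-unique : ∀ s s' → Unique (freshPair s s')
  freshPair-unique s s' = ((1+n≢n ∘ sym ∘ cong proj₂) ∷ []) ∷ [] ∷ []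

  ≣-decomposed : ∀ {s n ψ θ} → ((s , n) ∶ (ψ ≣ θ)) ∈ B →
    ∃₂ λ ls C → Dec ((s , n) ∶ (ψ ≣ θ)) ls C × C ⊆ B
  ≣-decomposed {pos} p∈B = decomposed (decomposition-applied ≣⁺₁ (freshPair-fresh _ _) (freshPair-unique _ _) p∈B)
  ≣-decomposed {neg} p∈B = decomposed (decomposition-applied ≣⁻₁ (freshPair-fresh _ _) (freshPair-unique _ _) p∈B)

  ≣⁺-components-∼ : ∀ {n ψ θ t x} → ((pos , n) ∶ (ψ ≣ θ)) ∈ B →
    (t ∶ ψ) ∈ B → (x ∶ θ) ∈ B → B ⊢ t ∼ x
  ≣⁺-components-∼ y∈B t∶ψ x∶θ with ≣-decomposed y∈B
  ... | _ , _ , ≣⁺₁ , C⊆B = ∼-transport t∶ψ x∶θ (C⊆B (here refl)) (C⊆B (there (here refl)))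
                                        (C⊆B (there (there (here refl))))
  ... | _ , _ , ≣⁺₂ , C⊆B = ∼-transport t∶ψ x∶θ (C⊆B (here refl)) (C⊆B (there (here refl)))
                                        (C⊆B (there (there (here refl))))

  ≣⁻-components-≁ : ∀ {n ψ θ t x} → ((neg , n) ∶ (ψ ≣ θ)) ∈ B →
    (t ∶ ψ) ∈ B → (x ∶ θ) ∈ B → ¬ B ⊢ t ∼ x
  ≣⁻-components-≁ {n} {ψ} {θ} y∈B t∶ψ x∶θ t∼x = refute (≣-decomposed y∈B)
    where
    components-∼ : ∀ {v u C} → ((v ∶ ψ) ∷ (u ∶ θ) ∷ C) ⊆ B → B ⊢ v ∼ u
    components-∼ C⊆B = ∼-transport (C⊆B (here refl)) (C⊆B (there (here refl))) t∶ψ x∶θ t∼x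

    refute : ¬ ∃₂ λ ls C → Dec ((neg , n) ∶ (ψ ≣ θ)) ls C × C ⊆ B
    refute (_ , _ , ≣⁻₁ , C⊆B) =
      closureRule-inapplicable (cl₁ (components-∼ C⊆B) (C⊆B (there (there (here refl)))))
    refute (_ , _ , ≣⁻₂ , C⊆B) with () ← ∼-sign (components-∼ C⊆B)
    refute (_ , _ , ≣⁻₃ , C⊆B) with () ← ∼-sign (components-∼ C⊆B)
    refute (_ , _ , ≣⁻₄ , C⊆B) =
      closureRule-inapplicable (cl₁ (components-∼ C⊆B) (C⊆B (there (there (here refl)))))

  module Structure (w₀ : ℕ) (ML : List Label) (R : Representatives B w₀ ML) where
    open Representatives R

    simU? : Decidable (SimU B)
    simU? top     t = no λ ()
    simU? (lab l) t = (l ≐ t) ∈? B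

    Carries : UE → Form → Set
    Carries w ψ = Labelled B (λ t φ → SimU B w t × φ ≡ ψ)

    carries? : Decidable Carries
    carries? w ψ = labelled? (λ t φ → simU? w t ×-dec φ ≟ᶠ ψ) B

    CarriesEqv : UE → UE → Form → Set
    CarriesEqv w v (ψ ≣ θ) = Carries w ψ × Carries v θ
    CarriesEqv w v _       = ⊥

    carriesEqv? : ∀ w v φ → Nullary.Dec (CarriesEqv w v φ)
    carriesEqv? w v (ψ ≣ θ) = carries? w ψ ×-dec carries? v θ
    carriesEqv? w v (atom _) = no λ ()
    carriesEqv? w v (¬' _)   = no λ ()
    carriesEqv? w v (_ ⇒ _)  = no λ ()

    -- the witness u of (≡)-closedness is recovered as the representative of the label y
    carriesEqv⇔eqvClosed : ∀ {w v} → Labelled B (λ _ → CarriesEqv w v) ⇔ EqvClosed B ML w v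
    carriesEqv⇔eqvClosed = mk⇔ to
      (λ (_ , _ , ψ , θ , t , x , y , w∼t , v∼x , _ , t∶ψ , x∶θ , y∶ψ≣θ) →
        y , ψ ≣ θ , y∶ψ≣θ , (t , ψ , t∶ψ , w∼t , refl) , (x , θ , x∶θ , v∼x , refl))
      where
      to : ∀ {w v} → Labelled B (λ _ → CarriesEqv w v) → EqvClosed B ML w v
      to (y , ψ ≣ θ , y∶ψ≣θ , (t , _ , t∶ψ , w∼t , refl) , (x , _ , x∶θ , v∼x , refl))
        with u , u∈ML , y∼u ← cover (ψ ≣ θ , y∶ψ≣θ) =
        u , u∈ML , ψ , θ , t , x , y , w∼t , v∼x , ∼-sym y∼u , t∶ψ , x∶θ , y∶ψ≣θ

    eqvClosed? : Decidable (EqvClosed B ML)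
    eqvClosed? w v = map carriesEqv⇔eqvClosed (labelled? (λ _ → carriesEqv? w v) B)

    eqvCond-unique : ∀ {w v u u'} → u ∈ ML → u' ∈ ML →
      EqvCond B w v u → EqvCond B w v u' → u ≡ u'
    eqvCond-unique {top} _ _ (_ , _ , _ , _ , _ , () , _) _
    eqvCond-unique {lab _} {top} _ _ (_ , _ , _ , _ , _ , _ , () , _) _
    eqvCond-unique {lab a} {lab b} u∈ML u'∈ML
      (_ , _ , _ , _ , y  , a∼t  , b∼x  , u∼y   , t∶ψ   , x∶θ   , y∶ψ≣θ)
      (_ , _ , _ , _ , y' , a∼t' , b∼x' , u'∼y' , t'∶ψ' , x'∶θ' , y'∶ψ'≣θ') =
      uniq u∈ML u'∈ML (∼-trans u∼y (∼-trans y∼y' (∼-sym u'∼y')))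
      where
      y∼y' : B ⊢ y ∼ y'
      y∼y' = equalityRule-closed (r≡≣ t∶ψ t'∶ψ' (∼-trans (∼-sym a∼t) a∼t')
                                      x∶θ x'∶θ' (∼-trans (∼-sym b∼x) b∼x') y∶ψ≣θ y'∶ψ'≣θ')

    closed⇒¬topCond : ∀ {w v} → EqvClosed B ML w v → ¬ EqvTopCond B ML w v
    closed⇒¬topCond (_ , _ , _ , _ , _ , _ , _ , () , _) (_ , inj₁ refl)
    closed⇒¬topCond closed (_ , inj₂ ¬closed) = ¬closed closed

    eqvVal-firstClause : ∀ {w v u z} → u ∈ ML → EqvCond B w v u →
      EqvVal B ML w₀ w v z → z ≡ lab u
    eqvVal-firstClause u∈ML c (c₁ u'∈ML c') = cong lab (eqvCond-unique u'∈ML u∈ML c' c)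
    eqvVal-firstClause u∈ML c (c₂ topCond)  = ⊥-elim (closed⇒¬topCond (_ , u∈ML , c) topCond)
    eqvVal-firstClause u∈ML c (c₃ ¬closed _) = ⊥-elim (¬closed (_ , u∈ML , c))

    eqvVal-unique : ∀ {w v z z'} → EqvVal B ML w₀ w v z → EqvVal B ML w₀ w v z' → z ≡ z'
    eqvVal-unique (c₁ u∈ML c) val = sym (eqvVal-firstClause u∈ML c val)
    eqvVal-unique val (c₁ u∈ML c) = eqvVal-firstClause u∈ML c val
    eqvVal-unique (c₂ _) (c₂ _) = refl
    eqvVal-unique (c₂ topCond) (c₃ _ ¬topCond) = ⊥-elim (¬topCond topCond)
    eqvVal-unique (c₃ _ ¬topCond) (c₂ topCond) = ⊥-elim (¬topCond topCond)
    eqvVal-unique (c₃ _ _) (c₃ _ _) = refl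

    eqvVal-exists : ∀ w v → ∃[ z ] (InU ML z × EqvVal B ML w₀ w v z)
    eqvVal-exists w v with eqvClosed? w v | w ≟ᵘ v
    ... | yes (u , u∈ML , c) | _     = lab u , u∈ML , c₁ u∈ML c
    ... | no ¬closed | yes w≡v = top , tt , c₂ (w≡v , inj₂ ¬closed)
    ... | no ¬closed | no  w≢v = lab (neg , w₀) , root∈ , c₃ ¬closed (w≢v ∘ proj₁)

    eqvCond-designated⇔ : ∀ {a b u} → a ∈ ML → b ∈ ML → u ∈ ML →
      EqvCond B (lab a) (lab b) u → InD ML (lab u) ⇔ lab a ≡ lab b
    eqvCond-designated⇔ {u = pos , _} a∈ML b∈ML u∈ML
      (_ , _ , _ , _ , _ , a∼t , b∼x , u∼y , t∶ψ , x∶θ , y∶ψ≣θ)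
      with refl ← ∼-sign u∼y =
      mk⇔ (λ _ → cong lab (uniq a∈ML b∈ML
                   (∼-trans a∼t (∼-trans (≣⁺-components-∼ y∶ψ≣θ t∶ψ x∶θ) (∼-sym b∼x)))))
          (λ _ → u∈ML , refl)
    eqvCond-designated⇔ {u = neg , _} a∈ML b∈ML u∈ML
      (_ , _ , _ , _ , _ , a∼t , a∼x , u∼y , t∶ψ , x∶θ , y∶ψ≣θ)
      with refl ← ∼-sign u∼y =
      mk⇔ (λ { (_ , ()) })
          (λ { refl → ⊥-elim (≣⁻-components-≁ y∶ψ≣θ t∶ψ x∶θ (∼-trans (∼-sym a∼t) a∼x)) })

    eqvVal-designated⇔ : ∀ {w v z} → InU ML w → InU ML v →
      EqvVal B ML w₀ w v z → InD ML z ⇔ w ≡ v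
    eqvVal-designated⇔ {lab _} {lab _} a∈ML b∈ML (c₁ u∈ML c) = eqvCond-designated⇔ a∈ML b∈ML u∈ML c
    eqvVal-designated⇔ {top} _ _ (c₁ _ (_ , _ , _ , _ , _ , () , _))
    eqvVal-designated⇔ {lab _} {top} _ _ (c₁ _ (_ , _ , _ , _ , _ , _ , () , _))
    eqvVal-designated⇔ _ _ (c₂ (w≡v , _)) = mk⇔ (λ _ → w≡v) (λ _ → tt)
    eqvVal-designated⇔ _ _ (c₃ ¬closed ¬topCond) =
      mk⇔ (λ { (_ , ()) }) (λ w≡v → ⊥-elim (¬topCond (w≡v , inj₂ ¬closed)))

proposition9 : (φ : Form) (w₀ : ℕ) (B : Branch) (used : List Item) →
    Reach φ w₀ (B , used) → Open (B , used) → FullyExpanded (B , used) →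
    (ML : List Label) → Representatives B w₀ ML →
    (∀ w v → InU ML w → InU ML v →
      ∃[ z ] (InU ML z × EqvVal B ML w₀ w v z × (∀ z' → EqvVal B ML w₀ w v z' → z' ≡ z)))
    × (∀ w v z → InU ML w → InU ML v → EqvVal B ML w₀ w v z → (InD ML z ⇔ w ≡ v))
proposition9 φ w₀ B used reach isOpen expanded ML R =
  (λ w v _ _ → function w v) , (λ _ _ _ → eqvVal-designated⇔)
  where
  stuck : ∀ s → ¬ Step (B , used) s
  stuck s st = [ isOpen , (λ noStep → noStep s st) ] expanded

  open Saturated B used stuck isOpen (reach⇒decomposed reach)
  open Structure w₀ ML R

  function : ∀ w v → ∃[ z ] (InU ML z × EqvVal B ML w₀ w v z ×
                             (∀ z' → EqvVal B ML w₀ w v z' → z' ≡ z))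
  function w v with z , z∈U , val ← eqvVal-exists w v =
    z , z∈U , val , λ _ val' → eqvVal-unique val' val
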